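{- Let $p$ be a prime, $\alpha\ge 1$ an integer, and let $u_1,\dots,u_{n-k}\in\mathbb{Z}^n$ and $v_1,\dots,v_m\in\mathbb{Z}^n$ be vectors satisfying $u_i\cdot u_i\not\equiv 0\pmod{p^\alpha}$ for all $i$; $u_i\cdot u_j\equiv 0\pmod{p^\alpha}$ for all $i\neq j$; $v_i\cdot v_j\equiv 0\pmod{p^\alpha}$ for all $i,j$ (including $i=j$); and $u_i\cdot v_j\equiv 0\pmod{p^\alpha}$ for all $i,j$. Then the subspace of $\mathbb{F}_p^n$ spanned over $\mathbb{F}_p$ by $v_1 \bmod p,\dots,v_m\bmod p$ has dimension at most $k/2$.
   Context: $x\cdot y$ denotes the standard dot product of integer vectors. -}

module Defs where

open import Data.Nat using (ℕ; zero; suc)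
open import Data.Fin using (Fin; zero; suc)
open import Data.Integer using (ℤ; +_; _+_; _*_; _-_)
open import Data.Integer.Divisibility using (_∣_)
open import Data.Product using (Σ; ∃; _×_)

Vecℤ : ℕ → Set
Vecℤ n = Fin n → ℤ

Σℤ : ∀ {n} → (Fin n → ℤ) → ℤ
Σℤ {zero}  f = + 0
Σℤ {suc n} f = f zero + Σℤ (λ i → f (suc i))

_·_ : ∀ {n} → Vecℤ n → Vecℤ n → ℤ
x · y = Σℤ (λ l → x l * y l)

_≡0mod_ : ℤ → ℕ → Set
x ≡0mod q = + q ∣ x

lincomb : ∀ {r n} → (Fin r → ℤ) → (Fin r → Vecℤ n) → Vecℤ n
lincomb c w l = Σℤ (λ i → c i * w i l)

InSpanMod : ∀ {m n} → ℕ → (Fin m → Vecℤ n) → Vecℤ n → Set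
InSpanMod {m} p v w = ∃ λ (a : Fin m → ℤ) → ∀ l → (w l - lincomb a v l) ≡0mod p

LinIndepMod : ∀ {r n} → ℕ → (Fin r → Vecℤ n) → Set
LinIndepMod {r} p w =
  (c : Fin r → ℤ) → (∀ l → lincomb c w l ≡0mod p) → ∀ i → c i ≡0mod p

-- The F_p-span of (v_j mod p) contains r linearly independent vectors.
-- dim span ≤ d  iff  every such r satisfies r ≤ d.
HasIndepInSpan : ∀ {m n} → ℕ → (Fin m → Vecℤ n) → ℕ → Set
HasIndepInSpan {n = n} p v r =
  Σ (Fin r → Vecℤ n) λ w → (∀ i → InSpanMod p v (w i)) × LinIndepMod p w

module Submission where

-- Replace the vectors w spanning the subspace by exact integer combinations of the v's: these are
-- isotropic and orthogonal to the u's modulo p^α, and still independent modulo p. Gaussian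
-- elimination over ℤ yields integer vectors y with y j · w l = t δ_jl for some t prime to p. If
-- (n - k) + 2r > n, the n - k + 2r vectors u, w, y in ℤ^n satisfy an integer relation whose
-- coefficients are not all divisible by p. Pairing it with w l shows that p^α divides the
-- y-coefficients; pairing it with u i then shows that p divides the u-coefficients, because
-- u i · u i ≢ 0 mod p^α; finally, read modulo p, independence of the w's makes p divide the
-- w-coefficients as well.

open import Defs
open import Data.Nat using (ℕ; zero; suc; _≤_; _<_; _^_; _∸_)
open import Data.Nat.Primality using (Prime)
open import Data.Fin using (Fin; zero; suc; punchIn; punchOut; splitAt; _↑ˡ_; _↑ʳ_)
open import Data.Integer using (ℤ)
open import Data.Integer.Divisibility.Signed using (∣ᵤ⇒∣; ∣⇒∣ᵤ)
open import Data.Vec.Functional using (_∷_; _++_; map; tail; insertAt)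
open import Data.Product using (∃; ∃₂; _×_; _,_; proj₁; proj₂)
open import Data.Sum using (_⊎_; inj₁; inj₂; [_,_]′)
open import Function using (_∘_)
open import Relation.Nullary using (¬_; yes; no; contradiction)
open import Relation.Binary.PropositionalEquality
  using (_≡_; _≢_; refl; sym; trans; cong; cong₂; subst; subst₂; module ≡-Reasoning)

-- The integer operations are opened only inside this module, so that _+_ and _*_ refer to ℕ in
-- the statement of lemma2p1 below.
module _ where
  import Data.Nat as ℕ
  import Data.Nat.Properties as ℕ
  import Data.Nat.Divisibility as ℕ
  open import Data.Nat.Primality using (euclidsLemma; prime⇒nonZero; prime⇒nonTrivial)
  import Data.Fin.Properties as Fin
  open import Data.Fin.Properties using (punchInᵢ≢i; punchIn-punchOut)
  open import Data.Vec.Functional.Properties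
    using (insertAt-lookup; insertAt-punchIn; lookup-++ˡ; lookup-++ʳ)
  open import Data.Integer using (+_; -_; 0ℤ; 1ℤ; _+_; _-_; _*_)
  import Data.Integer as ℤ
  open import Data.Integer.Properties
    using ( +-identityˡ; +-identityʳ; +-assoc; +-comm; +-inverseʳ; neg-distrib-+
          ; *-zeroʳ; *-identityʳ; *-assoc; *-comm; *-distribˡ-+; neg-distribˡ-*
          ; abs-*; pos-*; i*j≡0⇒i≡0∨j≡0; ∣i∣≡0⇒i≡0; _≟_
          ; +-commutativeSemigroup; *-commutativeSemigroup)
  open import Data.Integer.Divisibility.Signed
  open import Data.Integer.Tactic.RingSolver using (solve-∀)
  open import Algebra.Properties.CommutativeSemigroup +-commutativeSemigroup
    using (interchange; x∙yz≈y∙xz)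
  open import Algebra.Properties.CommutativeSemigroup *-commutativeSemigroup
    using (x∙yz≈y∙zx; xy∙z≈y∙xz)
  open ≡-Reasoning

  private variable
    A : Set
    n N M : ℕ
    d : ℤ

  Σℤ-cong : {f g : Fin n → ℤ} → (∀ i → f i ≡ g i) → Σℤ f ≡ Σℤ g
  Σℤ-cong {zero}  f≗g = refl
  Σℤ-cong {suc n} f≗g = cong₂ _+_ (f≗g zero) (Σℤ-cong (f≗g ∘ suc))

  Σℤ-zero : {f : Fin n → ℤ} → (∀ i → f i ≡ 0ℤ) → Σℤ f ≡ 0ℤ
  Σℤ-zero {zero}  f≗0 = refl
  Σℤ-zero {suc n} f≗0 = cong₂ _+_ (f≗0 zero) (Σℤ-zero (f≗0 ∘ suc))

  Σℤ-+ : (f g : Fin n → ℤ) → Σℤ (λ i → f i + g i) ≡ Σℤ f + Σℤ g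
  Σℤ-+ {zero}  f g = refl
  Σℤ-+ {suc n} f g = trans (cong (_+_ (f zero + g zero)) (Σℤ-+ (f ∘ suc) (g ∘ suc)))
                           (interchange (f zero) (g zero) _ _)

  Σℤ-neg : (f : Fin n → ℤ) → Σℤ (λ i → - f i) ≡ - Σℤ f
  Σℤ-neg {zero}  f = refl
  Σℤ-neg {suc n} f =
    trans (cong (_+_ (- f zero)) (Σℤ-neg (f ∘ suc))) (sym (neg-distrib-+ (f zero) _))

  Σℤ-− : (f g : Fin n → ℤ) → Σℤ (λ i → f i - g i) ≡ Σℤ f - Σℤ g
  Σℤ-− f g = trans (Σℤ-+ f (λ i → - g i)) (cong (_+_ (Σℤ f)) (Σℤ-neg g))

  *-distribˡ-Σℤ : (c : ℤ) (f : Fin n → ℤ) → c * Σℤ f ≡ Σℤ (λ i → c * f i)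
  *-distribˡ-Σℤ {zero}  c f = *-zeroʳ c
  *-distribˡ-Σℤ {suc n} c f =
    trans (*-distribˡ-+ c (f zero) _) (cong (_+_ (c * f zero)) (*-distribˡ-Σℤ c (f ∘ suc)))

  Σℤ-swap : (f : Fin M → Fin n → ℤ) → Σℤ (λ i → Σℤ (f i)) ≡ Σℤ (λ j → Σℤ (λ i → f i j))
  Σℤ-swap {zero}  {n} f = sym (Σℤ-zero {n} (λ _ → refl))
  Σℤ-swap {suc M} f =
    trans (cong (_+_ (Σℤ (f zero))) (Σℤ-swap (f ∘ suc))) (sym (Σℤ-+ (f zero) _))

  Σℤ-punchIn : (i : Fin (suc n)) (f : Fin (suc n) → ℤ) → Σℤ f ≡ f i + Σℤ (f ∘ punchIn i)
  Σℤ-punchIn         zero    f = refl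
  Σℤ-punchIn {suc n} (suc i) f =
    trans (cong (_+_ (f zero)) (Σℤ-punchIn i (f ∘ suc))) (x∙yz≈y∙xz (f zero) (f (suc i)) _)

  Σℤ-single : (i : Fin n) {f : Fin n → ℤ} → (∀ j → j ≢ i → f j ≡ 0ℤ) → Σℤ f ≡ f i
  Σℤ-single {suc n} i {f} f≗0 = begin
    Σℤ f                     ≡⟨ Σℤ-punchIn i f ⟩
    f i + Σℤ (f ∘ punchIn i) ≡⟨ cong (_+_ (f i)) (Σℤ-zero (λ j → f≗0 _ (punchInᵢ≢i i j))) ⟩
    f i + 0ℤ                 ≡⟨ +-identityʳ (f i) ⟩
    f i                      ∎

  Σℤ-++ : ∀ m (f : Fin (m ℕ.+ n) → ℤ) →
    Σℤ f ≡ Σℤ (λ i → f (i ↑ˡ n)) + Σℤ (λ j → f (m ↑ʳ j))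
  Σℤ-++ zero    f = sym (+-identityˡ _)
  Σℤ-++ (suc m) f =
    trans (cong (_+_ (f zero)) (Σℤ-++ m (f ∘ suc))) (sym (+-assoc (f zero) _ _))

  Σℤ-*-++ : (c : Fin (M ℕ.+ N) → ℤ) (f : Fin M → A) (g : Fin N → A) (φ : A → ℤ) →
    Σℤ (λ i → c i * φ ((f ++ g) i)) ≡
    Σℤ (λ i → c (i ↑ˡ N) * φ (f i)) + Σℤ (λ j → c (M ↑ʳ j) * φ (g j))
  Σℤ-*-++ {M} c f g φ = trans (Σℤ-++ M _) (cong₂ _+_
    (Σℤ-cong (λ i → cong (λ x → c (i ↑ˡ _) * φ x) (lookup-++ˡ f g i)))
    (Σℤ-cong (λ j → cong (λ x → c (M ↑ʳ j) * φ x) (lookup-++ʳ f g j))))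

  ∣0ℤ : d ∣ 0ℤ
  ∣0ℤ = divides 0ℤ refl

  ∣-Σℤ : {f : Fin n → ℤ} → (∀ i → d ∣ f i) → d ∣ Σℤ f
  ∣-Σℤ {zero}  _   = ∣0ℤ
  ∣-Σℤ {suc n} d∣f = ∣m∣n⇒∣m+n (d∣f zero) (∣-Σℤ (d∣f ∘ suc))

  ∣-Σℤ-except : (i : Fin n) {f : Fin n → ℤ} → (∀ j → j ≢ i → d ∣ f j) → d ∣ Σℤ f → d ∣ f i
  ∣-Σℤ-except {suc n} i {f} d∣f d∣Σ =
    ∣m+n∣n⇒∣m (subst (_ ∣_) (Σℤ-punchIn i f) d∣Σ) (∣-Σℤ (λ j → d∣f _ (punchInᵢ≢i i j)))

  module _ {x y z : ℤ} (x+y+z≡0 : x + (y + z) ≡ 0ℤ) where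
    private
      d∣x+y+z : d ∣ x + (y + z)
      d∣x+y+z = subst (_ ∣_) (sym x+y+z≡0) ∣0ℤ

    ∣-summand₁ : d ∣ y → d ∣ z → d ∣ x
    ∣-summand₁ d∣y d∣z = ∣m+n∣n⇒∣m d∣x+y+z (∣m∣n⇒∣m+n d∣y d∣z)

    ∣-summand₂ : d ∣ x → d ∣ z → d ∣ y
    ∣-summand₂ d∣x d∣z = ∣m+n∣n⇒∣m (∣m+n∣m⇒∣n d∣x+y+z d∣x) d∣z

    ∣-summand₃ : d ∣ x → d ∣ y → d ∣ z
    ∣-summand₃ d∣x d∣y = ∣m+n∣m⇒∣n (∣m+n∣m⇒∣n d∣x+y+z d∣x) d∣y

  ·-comm : (x y : Vecℤ n) → x · y ≡ y · x
  ·-comm x y = Σℤ-cong (λ l → *-comm (x l) (y l))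

  ·-zeroˡ : {x : Vecℤ n} (y : Vecℤ n) → (∀ l → x l ≡ 0ℤ) → x · y ≡ 0ℤ
  ·-zeroˡ y x≗0 = Σℤ-zero (λ l → cong (_* y l) (x≗0 l))

  ·-map-* : (a : ℤ) (x y : Vecℤ n) → map (a *_) x · y ≡ a * (x · y)
  ·-map-* a x y =
    trans (Σℤ-cong (λ l → *-assoc a (x l) (y l))) (sym (*-distribˡ-Σℤ a (λ l → x l * y l)))

  ·-linearʳ : (a b : ℤ) (x y z : Vecℤ n) →
    x · (λ l → a * y l - b * z l) ≡ a * (x · y) - b * (x · z)
  ·-linearʳ a b x y z = begin
    x · (λ l → a * y l - b * z l)
      ≡⟨ Σℤ-cong (λ l → distribute a b (x l) (y l) (z l)) ⟩
    Σℤ (λ l → a * (x l * y l) - b * (x l * z l))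
      ≡⟨ Σℤ-− (λ l → a * (x l * y l)) (λ l → b * (x l * z l)) ⟩
    Σℤ (λ l → a * (x l * y l)) - Σℤ (λ l → b * (x l * z l))
      ≡⟨ cong₂ _-_ (*-distribˡ-Σℤ a (λ l → x l * y l))
                   (*-distribˡ-Σℤ b (λ l → x l * z l)) ⟨
    a * (x · y) - b * (x · z) ∎
    where
    distribute : ∀ a b x y z → x * (a * y - b * z) ≡ a * (x * y) - b * (x * z)
    distribute = solve-∀

  lincomb-· : (c : Fin M → ℤ) (f : Fin M → Vecℤ n) (x : Vecℤ n) →
    lincomb c f · x ≡ Σℤ (λ i → c i * (f i · x))
  lincomb-· c f x = begin
    Σℤ (λ l → Σℤ (λ i → c i * f i l) * x l)
      ≡⟨ Σℤ-cong (λ l → trans (*-comm (Σℤ (λ i → c i * f i l)) (x l))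
                              (*-distribˡ-Σℤ (x l) (λ i → c i * f i l))) ⟩
    Σℤ (λ l → Σℤ (λ i → x l * (c i * f i l)))
      ≡⟨ Σℤ-swap (λ l i → x l * (c i * f i l)) ⟩
    Σℤ (λ i → Σℤ (λ l → x l * (c i * f i l)))
      ≡⟨ Σℤ-cong (λ i → trans (Σℤ-cong (λ l → x∙yz≈y∙zx (x l) (c i) (f i l)))
                              (sym (*-distribˡ-Σℤ (c i) (λ l → f i l * x l)))) ⟩
    Σℤ (λ i → c i * (f i · x)) ∎

  ∣-lincomb : {c : Fin M → ℤ} (f : Fin M → Vecℤ n) (l : Fin n) →
    (∀ i → d ∣ c i) → d ∣ lincomb c f l
  ∣-lincomb f l d∣c = ∣-Σℤ (λ i → ∣m⇒∣m*n (f i l) (d∣c i))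

  ∣-lincomb-· : (c : Fin M → ℤ) (f : Fin M → Vecℤ n) (x : Vecℤ n) →
    (∀ i → d ∣ f i · x) → d ∣ lincomb c f · x
  ∣-lincomb-· c f x d∣f·x =
    subst (_ ∣_) (sym (lincomb-· c f x)) (∣-Σℤ (λ i → ∣n⇒∣m*n (c i) (d∣f·x i)))

  ∣-·-lincomb : (x : Vecℤ n) (c : Fin M → ℤ) (f : Fin M → Vecℤ n) →
    (∀ i → d ∣ x · f i) → d ∣ x · lincomb c f
  ∣-·-lincomb x c f d∣x·f = subst (_ ∣_) (·-comm (lincomb c f) x)
    (∣-lincomb-· c f x (λ i → subst (_ ∣_) (·-comm x (f i)) (d∣x·f i)))

  ∣-lincomb-·-lincomb : (a b : Fin M → ℤ) (f : Fin M → Vecℤ n) →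
    (∀ i j → d ∣ f i · f j) → d ∣ lincomb a f · lincomb b f
  ∣-lincomb-·-lincomb a b f d∣f·f =
    ∣-lincomb-· a f (lincomb b f) (λ i → ∣-·-lincomb (f i) b f (d∣f·f i))

  prime∤1 : {p : ℕ} → Prime p → ¬ + p ∣ 1ℤ
  prime∤1 p-prime p∣1 with ℕ.∣1⇒≡1 (∣⇒∣ᵤ p∣1)
  ... | refl with prime⇒nonTrivial p-prime
  ... | ()

  prime∣*⇒∣⊎∣ : {p : ℕ} {x y : ℤ} → Prime p → + p ∣ x * y → + p ∣ x ⊎ + p ∣ y
  prime∣*⇒∣⊎∣ {x = x} {y} p-prime p∣xy
    with euclidsLemma ℤ.∣ x ∣ ℤ.∣ y ∣ p-prime (subst (_ ℕ.∣_) (abs-* x y) (∣⇒∣ᵤ p∣xy))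
  ... | inj₁ p∣x = inj₁ (∣ᵤ⇒∣ p∣x)
  ... | inj₂ p∣y = inj₂ (∣ᵤ⇒∣ p∣y)

  prime∣*⇒∣ʳ : {p : ℕ} {x y : ℤ} → Prime p → ¬ + p ∣ x → + p ∣ x * y → + p ∣ y
  prime∣*⇒∣ʳ p-prime p∤x p∣xy with prime∣*⇒∣⊎∣ p-prime p∣xy
  ... | inj₁ p∣x = contradiction p∣x p∤x
  ... | inj₂ p∣y = p∣y

  prime∤* : {p : ℕ} {x y : ℤ} → Prime p → ¬ + p ∣ x → ¬ + p ∣ y → ¬ + p ∣ x * y
  prime∤* p-prime p∤x p∤y = [ p∤x , p∤y ]′ ∘ prime∣*⇒∣⊎∣ p-prime

  p∣p^α : {p α : ℕ} → 1 ≤ α → + p ∣ + (p ^ α)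
  p∣p^α {p} {suc α} _ = ∣ᵤ⇒∣ (ℕ.m∣m*n (p ^ α))

  prime^∣*⇒∣ : {p : ℕ} {t : ℤ} → Prime p → ¬ + p ∣ t →
    ∀ α {c} → + (p ^ α) ∣ c * t → + (p ^ α) ∣ c
  prime^∣*⇒∣ p-prime p∤t zero    {c} _ = divides c (sym (*-identityʳ c))
  prime^∣*⇒∣ {p} {t} p-prime p∤t (suc α) {c} p^1+α∣ct
    with prime∣*⇒∣⊎∣ {x = c} p-prime (∣-trans (p∣p^α {α = suc α} (ℕ.s≤s ℕ.z≤n)) p^1+α∣ct)
  ... | inj₂ p∣t = contradiction p∣t p∤t
  ... | inj₁ (divides c′ refl) =
    subst₂ _∣_ (sym (pos-* p (p ^ α))) (*-comm (+ p) c′)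
      (*-monoʳ-∣ (+ p) (prime^∣*⇒∣ p-prime p∤t α p^α∣c′t))
    where
    p^α∣c′t : + (p ^ α) ∣ c′ * t
    p^α∣c′t = *-cancelˡ-∣ (+ p) {{prime⇒nonZero p-prime}}
      (subst₂ _∣_ (pos-* p (p ^ α)) (xy∙z≈y∙xz c′ (+ p) t) p^1+α∣ct)

  -i*j+k≡k-i*j : ∀ i j k → - i * j + k ≡ k - i * j
  -i*j+k≡k-i*j i j k = trans (cong (_+ k) (sym (neg-distribˡ-* i j))) (+-comm (- (i * j)) k)

  i*j-j*i≡0 : ∀ i j → i * j - j * i ≡ 0ℤ
  i*j-j*i≡0 i j = trans (cong (λ x → i * j - x) (*-comm j i)) (+-inverseʳ (i * j))

  -- One step of Gaussian elimination over ℤ on the first coordinate, pivoting on f i₀; as there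
  -- is no division, the other vectors are scaled by the pivot instead.
  module Pivot {N n : ℕ} (f : Fin (suc N) → Vecℤ (suc n)) (i₀ : Fin (suc N)) where
    pivot : ℤ
    pivot = f i₀ zero

    heads : Fin N → ℤ
    heads j = f (punchIn i₀ j) zero

    reduced : Fin N → Vecℤ n
    reduced j l = pivot * f (punchIn i₀ j) (suc l) - heads j * f i₀ (suc l)

    liftCoeff : (Fin N → ℤ) → Fin (suc N) → ℤ
    liftCoeff d = insertAt (map (pivot *_) d) i₀ (- (d · heads))

    liftCoeff-punchIn : (d : Fin N → ℤ) (j : Fin N) →
      liftCoeff d (punchIn i₀ j) ≡ pivot * d j
    liftCoeff-punchIn d = insertAt-punchIn (map (pivot *_) d) i₀ (- (d · heads))

    lincomb-liftCoeff : (d : Fin N → ℤ) (l : Fin (suc n)) →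
      lincomb (liftCoeff d) f l ≡ pivot * (d · λ j → f (punchIn i₀ j) l) - (d · heads) * f i₀ l
    lincomb-liftCoeff d l = begin
      lincomb (liftCoeff d) f l
        ≡⟨ Σℤ-punchIn i₀ (λ i → liftCoeff d i * f i l) ⟩
      liftCoeff d i₀ * f i₀ l + Σℤ (λ j → liftCoeff d (punchIn i₀ j) * f (punchIn i₀ j) l)
        ≡⟨ cong₂ _+_ (cong (_* f i₀ l) (insertAt-lookup (map (pivot *_) d) i₀ _))
                     (Σℤ-cong (λ j → cong (_* f (punchIn i₀ j) l) (liftCoeff-punchIn d j))) ⟩
      - (d · heads) * f i₀ l + Σℤ (λ j → pivot * d j * f (punchIn i₀ j) l)
        ≡⟨ cong (_+_ (- (d · heads) * f i₀ l))
             (trans (Σℤ-cong (λ j → *-assoc pivot (d j) _))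
                    (sym (*-distribˡ-Σℤ pivot (λ j → d j * f (punchIn i₀ j) l)))) ⟩
      - (d · heads) * f i₀ l + pivot * (d · λ j → f (punchIn i₀ j) l)
        ≡⟨ -i*j+k≡k-i*j (d · heads) (f i₀ l) _ ⟩
      pivot * (d · λ j → f (punchIn i₀ j) l) - (d · heads) * f i₀ l ∎

    lincomb-liftCoeff-zero : (d : Fin N → ℤ) → lincomb (liftCoeff d) f zero ≡ 0ℤ
    lincomb-liftCoeff-zero d = trans (lincomb-liftCoeff d zero) (i*j-j*i≡0 pivot (d · heads))

    lincomb-liftCoeff-suc : (d : Fin N → ℤ) (l : Fin n) →
      lincomb (liftCoeff d) f (suc l) ≡ lincomb d reduced l
    lincomb-liftCoeff-suc d l = begin
      lincomb (liftCoeff d) f (suc l)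
        ≡⟨ lincomb-liftCoeff d (suc l) ⟩
      pivot * (d · X) - (d · heads) * Y
        ≡⟨ cong (λ z → pivot * (d · X) - z) (*-comm (d · heads) Y) ⟩
      pivot * (d · X) - Y * (d · heads)
        ≡⟨ ·-linearʳ pivot Y d X heads ⟨
      d · (λ j → pivot * X j - Y * heads j)
        ≡⟨ Σℤ-cong (λ j → cong (λ z → d j * (pivot * X j - z)) (*-comm Y (heads j))) ⟩
      lincomb d reduced l ∎
      where
      X : Fin N → ℤ
      X j = f (punchIn i₀ j) (suc l)
      Y : ℤ
      Y = f i₀ (suc l)

    liftVec : Vecℤ n → Vecℤ (suc n)
    liftVec x = - (x · tail (f i₀)) ∷ map (pivot *_) x

    liftVec-· : (x : Vecℤ n) (v : Vecℤ (suc n)) →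
      liftVec x · v ≡ pivot * (x · tail v) - (x · tail (f i₀)) * v zero
    liftVec-· x v =
      trans (cong (_+_ (- (x · tail (f i₀)) * v zero)) (·-map-* pivot x (tail v)))
            (-i*j+k≡k-i*j (x · tail (f i₀)) (v zero) _)

    liftVec-·-pivot : (x : Vecℤ n) → liftVec x · f i₀ ≡ 0ℤ
    liftVec-·-pivot x = trans (liftVec-· x (f i₀)) (i*j-j*i≡0 pivot (x · tail (f i₀)))

    liftVec-·-punchIn : (x : Vecℤ n) (l : Fin N) →
      liftVec x · f (punchIn i₀ l) ≡ x · reduced l
    liftVec-·-punchIn x l = begin
      liftVec x · f (punchIn i₀ l)
        ≡⟨ liftVec-· x (f (punchIn i₀ l)) ⟩
      pivot * (x · tail (f (punchIn i₀ l))) - (x · tail (f i₀)) * heads l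
        ≡⟨ cong (λ z → pivot * (x · tail (f (punchIn i₀ l))) - z) (*-comm _ (heads l)) ⟩
      pivot * (x · tail (f (punchIn i₀ l))) - heads l * (x · tail (f i₀))
        ≡⟨ ·-linearʳ pivot (heads l) x (tail (f (punchIn i₀ l))) (tail (f i₀)) ⟨
      x · reduced l ∎

  IsRelation : (Fin N → ℤ) → (Fin N → Vecℤ n) → Set
  IsRelation c f = ∀ l → lincomb c f l ≡ 0ℤ

  nonzero-relation : n < N → (f : Fin N → Vecℤ n) →
    ∃₂ λ c i → c i ≢ 0ℤ × IsRelation c f
  nonzero-relation {zero}  {suc N} _ f = (λ _ → 1ℤ) , zero , (λ ()) , (λ ())
  nonzero-relation {suc n} {suc N} (ℕ.s≤s n<N) f with Fin.all? (λ i → f i zero ≟ 0ℤ)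
  ... | yes heads≡0 with nonzero-relation (ℕ.m≤n⇒m≤1+n n<N) (tail ∘ f)
  ...   | c , i , cᵢ≢0 , rel = c , i , cᵢ≢0 , λ where
          zero    → Σℤ-zero (λ j → trans (cong (c j *_) (heads≡0 j)) (*-zeroʳ (c j)))
          (suc l) → rel l
  nonzero-relation {suc n} {suc N} (ℕ.s≤s n<N) f
      | no ¬heads≡0 with Fin.¬∀⟶∃¬ _ _ (λ i → f i zero ≟ 0ℤ) ¬heads≡0
  ...   | i₀ , pivot≢0 with nonzero-relation n<N (Pivot.reduced f i₀)
  ...     | d , j , dⱼ≢0 , rel = liftCoeff d , punchIn i₀ j , liftCoeff≢0 , λ where
            zero    → lincomb-liftCoeff-zero d
            (suc l) → trans (lincomb-liftCoeff-suc d l) (rel l)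
    where
    open Pivot f i₀
    liftCoeff≢0 : liftCoeff d (punchIn i₀ j) ≢ 0ℤ
    liftCoeff≢0 eq = [ pivot≢0 , dⱼ≢0 ]′
      (i*j≡0⇒i≡0∨j≡0 pivot (trans (sym (liftCoeff-punchIn d j)) eq))

  nonzero⇒primitive-relation : {p : ℕ} → Prime p → {f : Fin N → Vecℤ n}
    (c : Fin N → ℤ) (i : Fin N) → c i ≢ 0ℤ → IsRelation c f →
    ∃ λ c′ → ¬ (∀ j → + p ∣ c′ j) × IsRelation c′ f
  nonzero⇒primitive-relation {p = p} p-prime {f} c i cᵢ≢0 rel =
    divide-out ℤ.∣ c i ∣ c cᵢ≢0 ℕ.≤-refl rel
    where
    divide-out : ∀ bound (c : Fin _ → ℤ) → c i ≢ 0ℤ → ℤ.∣ c i ∣ ≤ bound → IsRelation c f →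
      ∃ λ c′ → ¬ (∀ j → + p ∣ c′ j) × IsRelation c′ f
    divide-out zero c cᵢ≢0 ∣cᵢ∣≤0 _ = contradiction (∣i∣≡0⇒i≡0 (ℕ.n≤0⇒n≡0 ∣cᵢ∣≤0)) cᵢ≢0
    divide-out (suc bound) c cᵢ≢0 ∣cᵢ∣≤ rel with Fin.all? (λ j → + p ∣? c j)
    ... | no ¬p∣c = c , ¬p∣c , rel
    ... | yes p∣c =
      divide-out bound c/p c/pᵢ≢0 (ℕ.≤-pred (ℕ.<-≤-trans ∣c/pᵢ∣<∣cᵢ∣ ∣cᵢ∣≤)) rel/p
      where
      c/p : Fin _ → ℤ
      c/p j = _∣_.quotient (p∣c j)
      c≡c/p*p : ∀ j → c j ≡ c/p j * + p
      c≡c/p*p j = _∣_.equality (p∣c j)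
      c/pᵢ≢0 : c/p i ≢ 0ℤ
      c/pᵢ≢0 eq = cᵢ≢0 (trans (c≡c/p*p i) (cong (_* + p) eq))
      ∣c/pᵢ∣<∣cᵢ∣ : ℤ.∣ c/p i ∣ ℕ.< ℤ.∣ c i ∣
      ∣c/pᵢ∣<∣cᵢ∣ = subst (ℤ.∣ c/p i ∣ ℕ.<_)
        (sym (trans (cong ℤ.∣_∣ (c≡c/p*p i)) (abs-* (c/p i) (+ p))))
        (ℕ.m<m*n ℤ.∣ c/p i ∣ p {{ℕ.≢-nonZero (c/pᵢ≢0 ∘ ∣i∣≡0⇒i≡0)}}
          (ℕ.nonTrivial⇒n>1 p {{prime⇒nonTrivial p-prime}}))
      p*lincomb : ∀ l → + p * lincomb c/p f l ≡ lincomb c f l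
      p*lincomb l = trans (*-distribˡ-Σℤ (+ p) (λ j → c/p j * f j l))
        (Σℤ-cong (λ j → trans (sym (xy∙z≈y∙xz (c/p j) (+ p) (f j l)))
                               (cong (_* f j l) (sym (c≡c/p*p j)))))
      rel/p : IsRelation c/p f
      rel/p l with i*j≡0⇒i≡0∨j≡0 (+ p) (trans (p*lincomb l) (rel l))
      ... | inj₁ p≡0 =
        contradiction (cong ℤ.∣_∣ p≡0) (ℕ.≢-nonZero⁻¹ p {{prime⇒nonZero p-prime}})
      ... | inj₂ eq = eq

  primitive-relation : {p : ℕ} → Prime p → n < N → (f : Fin N → Vecℤ n) →
    ∃ λ c → ¬ (∀ i → + p ∣ c i) × IsRelation c f
  primitive-relation p-prime n<N f with nonzero-relation n<N f
  ... | c , i , cᵢ≢0 , rel = nonzero⇒primitive-relation p-prime c i cᵢ≢0 rel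

  Independent : ℕ → (Fin M → Vecℤ n) → Set
  Independent p g = ∀ c → (∀ l → + p ∣ lincomb c g l) → ∀ i → + p ∣ c i

  record DualFamily {M n : ℕ} (p : ℕ) (g : Fin M → Vecℤ n) : Set where
    field
      scale     : ℤ
      p∤scale   : ¬ + p ∣ scale
      dual      : Fin M → Vecℤ n
      dual-diag : ∀ j → dual j · g j ≡ scale
      dual-off  : ∀ j l → j ≢ l → dual j · g l ≡ 0ℤ

  Independent-tail : {p : ℕ} {g : Fin M → Vecℤ (suc n)} →
    (∀ i → + p ∣ g i zero) → Independent p g → Independent p (tail ∘ g)
  Independent-tail p∣heads indep c p∣lincomb = indep c λ where
    zero    → ∣-Σℤ (λ i → ∣n⇒∣m*n (c i) (p∣heads i))
    (suc l) → p∣lincomb l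

  DualFamily-tail : {p : ℕ} {g : Fin M → Vecℤ (suc n)} →
    DualFamily p (tail ∘ g) → DualFamily p g
  DualFamily-tail D = record
    { scale     = scale
    ; p∤scale   = p∤scale
    ; dual      = λ j → 0ℤ ∷ dual j
    ; dual-diag = λ j → trans (+-identityˡ _) (dual-diag j)
    ; dual-off  = λ j l j≢l → trans (+-identityˡ _) (dual-off j l j≢l)
    }
    where open DualFamily D

  reduced-independent : {p : ℕ} → Prime p →
    {g : Fin (suc M) → Vecℤ (suc n)} {i₀ : Fin (suc M)} →
    ¬ + p ∣ Pivot.pivot g i₀ → Independent p g → Independent p (Pivot.reduced g i₀)
  reduced-independent p-prime {g} {i₀} p∤pivot indep d p∣lincomb j =
    prime∣*⇒∣ʳ {x = pivot} p-prime p∤pivot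
      (subst (_ ∣_) (liftCoeff-punchIn d j) (indep (liftCoeff d) p∣lifted (punchIn i₀ j)))
    where
    open Pivot g i₀
    p∣lifted : ∀ l → _ ∣ lincomb (liftCoeff d) g l
    p∣lifted zero    = subst (_ ∣_) (sym (lincomb-liftCoeff-zero d)) ∣0ℤ
    p∣lifted (suc l) = subst (_ ∣_) (sym (lincomb-liftCoeff-suc d l)) (p∣lincomb l)

  pivot-or-punchIn : (i₀ i : Fin (suc N)) → i₀ ≡ i ⊎ ∃ λ j → punchIn i₀ j ≡ i
  pivot-or-punchIn i₀ i with i₀ Fin.≟ i
  ... | yes i₀≡i = inj₁ i₀≡i
  ... | no  i₀≢i = inj₂ (punchOut i₀≢i , punchIn-punchOut i₀≢i)

  module ExtendDual {p : ℕ} {M n : ℕ} (g : Fin (suc M) → Vecℤ (suc n)) (i₀ : Fin (suc M))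
                    (D : DualFamily p (Pivot.reduced g i₀)) where
    open Pivot g i₀
    open DualFamily D

    combined : Vecℤ n
    combined = lincomb heads dual

    -- scale · e₀ - liftVec combined, written out
    y₀ : Vecℤ (suc n)
    y₀ = (scale + combined · tail (g i₀)) ∷ map (- pivot *_) combined

    -- the lifted duals are scaled by pivot so that every diagonal entry is scale * pivot
    y : Fin (suc M) → Vecℤ (suc n)
    y = insertAt (λ j → map (pivot *_) (liftVec (dual j))) i₀ y₀

    combined-·-reduced : ∀ l → combined · reduced l ≡ heads l * scale
    combined-·-reduced l = begin
      combined · reduced l
        ≡⟨ lincomb-· heads dual (reduced l) ⟩
      Σℤ (λ j → heads j * (dual j · reduced l))
        ≡⟨ Σℤ-single l (λ j j≢l →
             trans (cong (heads j *_) (dual-off j l j≢l)) (*-zeroʳ (heads j))) ⟩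
      heads l * (dual l · reduced l)
        ≡⟨ cong (heads l *_) (dual-diag l) ⟩
      heads l * scale ∎

    y₀-· : ∀ v → y₀ · v ≡ scale * v zero - liftVec combined · v
    y₀-· v = begin
      y₀ · v
        ≡⟨ cong (_+_ ((scale + W) * v zero)) (·-map-* (- pivot) combined (tail v)) ⟩
      (scale + W) * v zero + (- pivot) * (combined · tail v)
        ≡⟨ rearrange scale W (v zero) pivot (combined · tail v) ⟩
      scale * v zero - (pivot * (combined · tail v) - W * v zero)
        ≡⟨ cong (λ z → scale * v zero - z) (liftVec-· combined v) ⟨
      scale * v zero - liftVec combined · v ∎
      where
      W = combined · tail (g i₀)
      rearrange : ∀ s w v₀ a t → (s + w) * v₀ + (- a) * t ≡ s * v₀ - (a * t - w * v₀)
      rearrange = solve-∀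

    y-pivot : y i₀ ≡ y₀
    y-pivot = insertAt-lookup _ i₀ y₀

    y-punchIn-· : ∀ j v → y (punchIn i₀ j) · v ≡ pivot * (liftVec (dual j) · v)
    y-punchIn-· j v =
      trans (cong (_· v) (insertAt-punchIn _ i₀ y₀ j)) (·-map-* pivot (liftVec (dual j)) v)

    y-·-pivot : y i₀ · g i₀ ≡ scale * pivot
    y-·-pivot = begin
      y i₀ · g i₀                             ≡⟨ cong (_· g i₀) y-pivot ⟩
      y₀ · g i₀                               ≡⟨ y₀-· (g i₀) ⟩
      scale * pivot - liftVec combined · g i₀
        ≡⟨ cong (λ z → scale * pivot - z) (liftVec-·-pivot combined) ⟩
      scale * pivot - 0ℤ                      ≡⟨ +-identityʳ _ ⟩
      scale * pivot                           ∎

    y-pivot-·-punchIn : ∀ l → y i₀ · g (punchIn i₀ l) ≡ 0ℤ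
    y-pivot-·-punchIn l = begin
      y i₀ · g (punchIn i₀ l)           ≡⟨ cong (_· g (punchIn i₀ l)) y-pivot ⟩
      y₀ · g (punchIn i₀ l)             ≡⟨ y₀-· (g (punchIn i₀ l)) ⟩
      scale * heads l - liftVec combined · g (punchIn i₀ l)
        ≡⟨ cong (λ z → scale * heads l - z) (liftVec-·-punchIn combined l) ⟩
      scale * heads l - combined · reduced l
        ≡⟨ cong (λ z → scale * heads l - z) (combined-·-reduced l) ⟩
      scale * heads l - heads l * scale ≡⟨ i*j-j*i≡0 scale (heads l) ⟩
      0ℤ                                ∎

    y-punchIn-·-pivot : ∀ j → y (punchIn i₀ j) · g i₀ ≡ 0ℤ
    y-punchIn-·-pivot j = trans (y-punchIn-· j (g i₀))
      (trans (cong (pivot *_) (liftVec-·-pivot (dual j))) (*-zeroʳ pivot))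

    y-punchIn-·-punchIn : ∀ j l →
      y (punchIn i₀ j) · g (punchIn i₀ l) ≡ pivot * (dual j · reduced l)
    y-punchIn-·-punchIn j l = trans (y-punchIn-· j (g (punchIn i₀ l)))
      (cong (pivot *_) (liftVec-·-punchIn (dual j) l))

    y-diag : ∀ i → y i · g i ≡ scale * pivot
    y-diag i with pivot-or-punchIn i₀ i
    ... | inj₁ refl       = y-·-pivot
    ... | inj₂ (j , refl) = trans (y-punchIn-·-punchIn j j)
      (trans (cong (pivot *_) (dual-diag j)) (*-comm pivot scale))

    y-off : ∀ i l → i ≢ l → y i · g l ≡ 0ℤ
    y-off i l i≢l with pivot-or-punchIn i₀ i | pivot-or-punchIn i₀ l
    ... | inj₁ refl       | inj₁ refl        = contradiction refl i≢l
    ... | inj₁ refl       | inj₂ (l′ , refl) = y-pivot-·-punchIn l′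
    ... | inj₂ (j , refl) | inj₁ refl        = y-punchIn-·-pivot j
    ... | inj₂ (j , refl) | inj₂ (l′ , refl) = trans (y-punchIn-·-punchIn j l′)
      (trans (cong (pivot *_) (dual-off j l′ (i≢l ∘ cong (punchIn i₀)))) (*-zeroʳ pivot))

  DualFamily-reduced : {p : ℕ} → Prime p →
    {g : Fin (suc M) → Vecℤ (suc n)} {i₀ : Fin (suc M)} →
    ¬ + p ∣ Pivot.pivot g i₀ → DualFamily p (Pivot.reduced g i₀) → DualFamily p g
  DualFamily-reduced p-prime {g} {i₀} p∤pivot D = record
    { scale     = scale * pivot
    ; p∤scale   = prime∤* p-prime p∤scale p∤pivot
    ; dual      = y
    ; dual-diag = y-diag
    ; dual-off  = y-off
    }
    where
    open Pivot g i₀ using (pivot)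
    open DualFamily D using (scale; p∤scale)
    open ExtendDual g i₀ D using (y; y-diag; y-off)

  independent⇒dual : {p : ℕ} → Prime p →
    (g : Fin M → Vecℤ n) → Independent p g → DualFamily p g
  independent⇒dual {zero} p-prime g _ = record
    { scale = 1ℤ ; p∤scale = prime∤1 p-prime ; dual = λ () ; dual-diag = λ () ; dual-off = λ () }
  independent⇒dual {suc M} {zero} p-prime g indep =
    contradiction (indep (λ _ → 1ℤ) (λ ()) zero) (prime∤1 p-prime)
  independent⇒dual {suc M} {suc n} {p} p-prime g indep with Fin.all? (λ i → + p ∣? g i zero)
  ... | yes p∣heads = DualFamily-tail {g = g}
    (independent⇒dual p-prime (tail ∘ g) (Independent-tail {g = g} p∣heads indep))
  ... | no ¬p∣heads with Fin.¬∀⟶∃¬ _ _ (λ i → + p ∣? g i zero) ¬p∣heads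
  ...   | i₀ , p∤pivot = DualFamily-reduced p-prime {g} {i₀} p∤pivot
    (independent⇒dual p-prime (Pivot.reduced g i₀)
      (reduced-independent p-prime {g} {i₀} p∤pivot indep))

  LinIndepMod⇒Independent : {p : ℕ} {g : Fin M → Vecℤ n} → LinIndepMod p g → Independent p g
  LinIndepMod⇒Independent indep c p∣lincomb i = ∣ᵤ⇒∣ (indep c (∣⇒∣ᵤ ∘ p∣lincomb) i)

  Independent-≡mod : {p : ℕ} {w w′ : Fin M → Vecℤ n} →
    (∀ i l → + p ∣ w i l - w′ i l) → Independent p w → Independent p w′
  Independent-≡mod {w = w} {w′} w≡w′ indep c p∣lincomb′ = indep c λ l →
    subst (_ ∣_) (split l) (∣m∣n⇒∣m+n (∣-Σℤ (λ i → ∣n⇒∣m*n (c i) (w≡w′ i l))) (p∣lincomb′ l))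
    where
    split : ∀ l → lincomb c (λ i k → w i k - w′ i k) l + lincomb c w′ l ≡ lincomb c w l
    split l = trans (sym (Σℤ-+ (λ i → c i * (w i l - w′ i l)) (λ i → c i * w′ i l)))
                    (Σℤ-cong (λ i → distrib (c i) (w i l) (w′ i l)))
      where
      distrib : ∀ c x y → c * (x - y) + c * y ≡ c * x
      distrib = solve-∀

  ++-∀ : {P : Fin (M ℕ.+ N) → Set} → (∀ i → P (i ↑ˡ N)) → (∀ j → P (M ↑ʳ j)) → ∀ k → P k
  ++-∀ {M} {N} Pˡ Pʳ k with splitAt M k | Fin.join-splitAt M N k
  ... | inj₁ i | refl = Pˡ i
  ... | inj₂ j | refl = Pʳ j

  module _ {p α : ℕ} (p-prime : Prime p) (α≥1 : 1 ≤ α) where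
    private
      q : ℤ
      q = + (p ^ α)

    module _ {s r n : ℕ} (u : Fin s → Vecℤ n) (w : Fin r → Vecℤ n)
             (u-anisotropic : ∀ i → ¬ q ∣ u i · u i)
             (u-orthogonal : ∀ i j → i ≢ j → q ∣ u i · u j)
             (w-isotropic : ∀ i j → q ∣ w i · w j)
             (u⊥w : ∀ i j → q ∣ u i · w j)
             (w-independent : Independent p w) where
      open DualFamily (independent⇒dual p-prime w w-independent)

      module _ (c : Fin (s ℕ.+ (r ℕ.+ r)) → ℤ) (rel : IsRelation c (u ++ (w ++ dual))) where
        private
          a : Fin s → ℤ
          a i = c (i ↑ˡ (r ℕ.+ r))
          b e : Fin r → ℤ
          b j = c (s ↑ʳ (j ↑ˡ r))
          e j = c (s ↑ʳ (r ↑ʳ j))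

          split : (φ : Vecℤ n → ℤ) → Σℤ (λ i → c i * φ ((u ++ (w ++ dual)) i)) ≡
            Σℤ (λ i → a i * φ (u i)) + (Σℤ (λ j → b j * φ (w j)) + Σℤ (λ j → e j * φ (dual j)))
          split φ = trans (Σℤ-*-++ c u (w ++ dual) φ)
            (cong (_+_ (Σℤ (λ i → a i * φ (u i)))) (Σℤ-*-++ (λ j → c (s ↑ʳ j)) w dual φ))

          relation-· : ∀ x → Σℤ (λ i → a i * (u i · x)) +
            (Σℤ (λ j → b j * (w j · x)) + Σℤ (λ j → e j * (dual j · x))) ≡ 0ℤ
          relation-· x = trans (sym (split (_· x)))
            (trans (sym (lincomb-· c (u ++ (w ++ dual)) x)) (·-zeroˡ x rel))

          relation-coordinate : ∀ l → lincomb a u l + (lincomb b w l + lincomb e dual l) ≡ 0ℤ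
          relation-coordinate l = trans (sym (split (λ x → x l))) (rel l)

          q∣e : ∀ j → q ∣ e j
          q∣e j = prime^∣*⇒∣ p-prime p∤scale α (subst (q ∣_) e-part
            (∣-summand₃ (relation-· (w j)) (∣-Σℤ (λ i → ∣n⇒∣m*n (a i) (u⊥w i j)))
                                           (∣-Σℤ (λ k → ∣n⇒∣m*n (b k) (w-isotropic k j)))))
            where
            e-part : Σℤ (λ k → e k * (dual k · w j)) ≡ e j * scale
            e-part = trans
              (Σℤ-single j (λ k k≢j → trans (cong (e k *_) (dual-off k j k≢j)) (*-zeroʳ (e k))))
              (cong (e j *_) (dual-diag j))

          p∣e : ∀ j → + p ∣ e j
          p∣e j = ∣-trans (p∣p^α α≥1) (q∣e j)

          q∣aᵢ*uᵢ·uᵢ : ∀ i → q ∣ a i * (u i · u i)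
          q∣aᵢ*uᵢ·uᵢ i = ∣-Σℤ-except i (λ j j≢i → ∣n⇒∣m*n (a j) (u-orthogonal j i j≢i))
            (∣-summand₁ (relation-· (u i))
              (∣-Σℤ (λ j → ∣n⇒∣m*n (b j) (subst (q ∣_) (·-comm (u i) (w j)) (u⊥w i j))))
              (∣-Σℤ (λ j → ∣m⇒∣m*n (dual j · u i) (q∣e j))))

          p∣a : ∀ i → + p ∣ a i
          p∣a i with + p ∣? a i
          ... | yes p∣aᵢ = p∣aᵢ
          ... | no  p∤aᵢ = contradiction
            (prime^∣*⇒∣ p-prime p∤aᵢ α (subst (q ∣_) (*-comm (a i) (u i · u i)) (q∣aᵢ*uᵢ·uᵢ i)))
            (u-anisotropic i)

          p∣b : ∀ j → + p ∣ b j
          p∣b = w-independent b λ l →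
            ∣-summand₂ (relation-coordinate l) (∣-lincomb u l p∣a) (∣-lincomb dual l p∣e)

        relation-coefficients-divisible : ∀ i → + p ∣ c i
        relation-coefficients-divisible = ++-∀ p∣a (++-∀ p∣b p∣e)

      isotropic-bound : s ℕ.+ (r ℕ.+ r) ≤ n
      isotropic-bound = ℕ.≮⇒≥ λ n<size →
        let c , c-primitive , rel = primitive-relation p-prime n<size (u ++ (w ++ dual))
        in c-primitive (relation-coefficients-divisible c rel)

open import Data.Nat using (_+_; _*_)
open import Data.Nat.Properties using (+-cancelˡ-≤; m∸n+n≡m; +-identityʳ)

lemma2p1 : (p α n k m : ℕ) → Prime p → 1 ≤ α → k ≤ n →
    (u : Fin (n ∸ k) → Vecℤ n) → (v : Fin m → Vecℤ n) →
    (∀ i → ¬ ((u i · u i) ≡0mod (p ^ α))) →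
    (∀ i j → i ≢ j → (u i · u j) ≡0mod (p ^ α)) →
    (∀ i j → (v i · v j) ≡0mod (p ^ α)) →
    (∀ i j → (u i · v j) ≡0mod (p ^ α)) →
    ∀ r → HasIndepInSpan p v r → 2 * r ≤ k
lemma2p1 p α n k m p-prime α≥1 k≤n u v u-anisotropic u-orthogonal v-isotropic u⊥v
  r (w , w∈span , w-independent) =
  +-cancelˡ-≤ (n ∸ k) (2 * r) k
    (subst₂ (λ x y → n ∸ k + x ≤ y) (cong (r +_) (sym (+-identityʳ r))) (sym (m∸n+n≡m k≤n)) bound)
  where
  coefficients : Fin r → Fin m → ℤ
  coefficients i = proj₁ (w∈span i)

  lifts : Fin r → Vecℤ n
  lifts i = lincomb (coefficients i) v

  bound : n ∸ k + (r + r) ≤ n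
  bound = isotropic-bound p-prime α≥1 u lifts
    (λ i → u-anisotropic i ∘ ∣⇒∣ᵤ)
    (λ i j i≢j → ∣ᵤ⇒∣ (u-orthogonal i j i≢j))
    (λ i j → ∣-lincomb-·-lincomb (coefficients i) (coefficients j) v (λ a b → ∣ᵤ⇒∣ (v-isotropic a b)))
    (λ i j → ∣-·-lincomb (u i) (coefficients j) v (λ a → ∣ᵤ⇒∣ (u⊥v i a)))
    (Independent-≡mod (λ i l → ∣ᵤ⇒∣ (proj₂ (w∈span i) l)) (LinIndepMod⇒Independent w-independent))
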